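{- Let $\mathcal N$ be a normal network on $X$ and let $u$ be a tree vertex of $\mathcal N$. Let $\mathcal T$ be a phylogenetic $X$-tree having $C_u$ as a cluster. If $\mathcal S$ is an embedding of $\mathcal T$ in $\mathcal N$, then the vertex in $\mathcal S$ corresponding to $C_u$ is $u$.
   Context: A phylogenetic network $\mathcal N$ on a non-empty finite set $X$ is a rooted acyclic directed graph with no parallel arcs such that: the root has out-degree two; every vertex of out-degree zero has in-degree one and the set of such vertices (leaves) is $X$; every other vertex has either in-degree one and out-degree two (tree vertex) or in-degree two and out-degree one (reticulation). (If $|X|=1$ a single labelled vertex is also allowed.) A phylogenetic $X$-tree is such a network with no reticulations. A reticulation arc $(u,v)$ (an arc into a reticulation) is a shortcut if there is a directed path from $u$ to $v$ not traversing $(u,v)$. $\mathcal N$ is tree-child if every non-leaf vertex is the parent of a tree vertex or a leaf, and normal if it is tree-child with no shortcuts. For a vertex $u$ of $\mathcal N$, $C_u$ is the set of leaves reachable from $u$ by a directed path. A subset $C\subseteq X$ is a cluster of a phylogenetic $X$-tree $\mathcal T$ if $C$ is the set of leaves below some vertex of $\mathcal T$. $\mathcal N$ displays $\mathcal T$ if, up to suppressing vertices of in-degree one and out-degree one, $\mathcal T$ can be obtained from $\mathcal N$ by deleting arcs and non-root vertices; the resulting subgraph $\mathcal S$ of $\mathcal N$ (whose root is the root of $\mathcal N$, possibly of out-degree one) is an embedding of $\mathcal T$ in $\mathcal N$. Each vertex $w$ of $\mathcal S$ has a cluster set relative to $\mathcal S$, namely the leaves reachable from $w$ by paths in $\mathcal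 S$. For a cluster $C$ of $\mathcal T$, the vertex of $\mathcal S$ corresponding to $C$ is the unique vertex $u$ of $\mathcal S$ whose cluster set relative to $\mathcal S$ is $C$ and such that every other vertex of $\mathcal S$ with cluster set $C$ lies on a path in $\mathcal S$ from the root to $u$. -}

module Defs where

open import Data.Nat using (ℕ; zero; suc; _+_)
open import Data.Fin using (Fin; _≟_)
open import Relation.Nullary using (yes)
open import Data.Bool using (Bool; true; false; if_then_else_)
open import Data.List using (List; map)
open import Data.Nat.ListAction using (sum)
open import Data.List.Base using (allFin)
open import Data.Product using (Σ; ∃; _×_; _,_)
open import Data.Sum using (_⊎_)
open import Relation.Nullary using (¬_)
open import Relation.Binary.PropositionalEquality using (_≡_; _≢_)
open import Relation.Binary.Construct.Closure.ReflexiveTransitive using (Star)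
open import Relation.Binary.Construct.Closure.Transitive using (TransClosure)
open import Function.Bundles using (_⇔_)
open import Function.Definitions using (Injective)

-- Directed graphs on the vertex set Fin n, given by a Boolean adjacency
-- function (so there are no parallel arcs).  The leaf set X is Fin m.

Adj : ℕ → Set
Adj n = Fin n → Fin n → Bool

Arc : ∀ {n} → Adj n → Fin n → Fin n → Set
Arc A u v = A u v ≡ true

count : ∀ {n} → (Fin n → Bool) → ℕ
count {n} p = sum (map (λ w → if p w then 1 else 0) (allFin n))

outdeg : ∀ {n} → Adj n → Fin n → ℕ
outdeg A v = count (λ w → A v w)

indeg : ∀ {n} → Adj n → Fin n → ℕ
indeg A v = count (λ w → A w v)

Path : ∀ {n} → Adj n → Fin n → Fin n → Set
Path A = Star (Arc A)

Path⁺ : ∀ {n} → Adj n → Fin n → Fin n → Set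
Path⁺ A = TransClosure (Arc A)

Acyclic : ∀ {n} → Adj n → Set
Acyclic A = ∀ v → ¬ Path⁺ A v v

record Net (m n : ℕ) : Set where
  field
    arc  : Adj n
    root : Fin n
    leaf : Fin m → Fin n
open Net public

IsLeaf : ∀ {m n} → Net m n → Fin n → Set
IsLeaf N v = outdeg (arc N) v ≡ 0

IsTreeVertex : ∀ {m n} → Net m n → Fin n → Set
IsTreeVertex N v = indeg (arc N) v ≡ 1 × outdeg (arc N) v ≡ 2

IsReticulation : ∀ {m n} → Net m n → Fin n → Set
IsReticulation N v = indeg (arc N) v ≡ 2 × outdeg (arc N) v ≡ 1

LeafLabelling : ∀ {m n} → Net m n → Set
LeafLabelling N =
  Injective _≡_ _≡_ (leaf N) ×
  (∀ x → IsLeaf N (leaf N x)) ×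
  (∀ v → IsLeaf N v → ∃ λ x → leaf N x ≡ v)

IsProperNetwork : ∀ {m n} → Net m n → Set
IsProperNetwork N =
  Acyclic (arc N) ×
  indeg (arc N) (root N) ≡ 0 ×
  outdeg (arc N) (root N) ≡ 2 ×
  (∀ v → v ≢ root N →
     (IsLeaf N v × indeg (arc N) v ≡ 1) ⊎ IsTreeVertex N v ⊎ IsReticulation N v) ×
  LeafLabelling N

-- the degenerate case |X| = 1: a single labelled vertex
IsSingleVertex : ∀ {m n} → Net m n → Set
IsSingleVertex {m} {n} N = m ≡ 1 × n ≡ 1 × (∀ u v → arc N u v ≡ false)

IsPhyloNetwork : ∀ {m n} → Net m n → Set
IsPhyloNetwork N = IsProperNetwork N ⊎ IsSingleVertex N

IsPhyloTree : ∀ {m n} → Net m n → Set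
IsPhyloTree N = IsPhyloNetwork N × (∀ v → ¬ IsReticulation N v)

IsTreeChild : ∀ {m n} → Net m n → Set
IsTreeChild N =
  ∀ v → ¬ IsLeaf N v →
  ∃ λ w → Arc (arc N) v w × (IsTreeVertex N w ⊎ IsLeaf N w)

removeArc : ∀ {n} → Adj n → Fin n → Fin n → Adj n
removeArc A u v a b with _≟_ a u | _≟_ b v
... | yes _ | yes _ = false
... | _ | _ = A a b

IsShortcut : ∀ {m n} → Net m n → Fin n → Fin n → Set
IsShortcut N u v =
  Arc (arc N) u v × IsReticulation N v × Path (removeArc (arc N) u v) u v

IsNormal : ∀ {m n} → Net m n → Set
IsNormal N =
  IsPhyloNetwork N × IsTreeChild N × (∀ u v → ¬ IsShortcut N u v)

Cl : ∀ {m n} → Net m n → Fin n → Fin m → Set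
Cl N u x = Path (arc N) u (leaf N x)

IsCluster : ∀ {m k} → Net m k → (Fin m → Set) → Set
IsCluster T C = ∃ λ t → ∀ x → Cl T t x ⇔ C x

-- A subgraph S of N (vertex set vS, arc set aS) is an
-- embedding of T if T is obtained from S by suppressing vertices of
-- in-degree one and out-degree one.  This is witnessed by a map φ from
-- the vertices of T onto the non-suppressed vertices of S such that the
-- arcs of T are exactly the pairs joined in S by a path whose interior
-- consists of suppressed vertices.

record Sub (n : ℕ) : Set where
  field
    vS : Fin n → Bool
    aS : Adj n
open Sub public

data IPath {n} (A : Adj n) (P : Fin n → Set) : Fin n → Fin n → Set where
  one  : ∀ {u v} → Arc A u v → IPath A P u v
  step : ∀ {u w v} → Arc A u w → P w → IPath A P w v → IPath A P u v

record IsEmbedding {m n k} (N : Net m n) (T : Net m k) (S : Sub n) : Set where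
  field
    sub-arc    : ∀ u v → Arc (aS S) u v → Arc (arc N) u v
    sub-tail   : ∀ u v → Arc (aS S) u v → vS S u ≡ true
    sub-head   : ∀ u v → Arc (aS S) u v → vS S v ≡ true
    sub-root   : vS S (root N) ≡ true
    φ          : Fin k → Fin n
    φ-inj      : Injective _≡_ _≡_ φ
    φ-in       : ∀ t → vS S (φ t) ≡ true
    φ-leaf     : ∀ x → φ (leaf T x) ≡ leaf N x
    φ-outdeg   : ∀ t → outdeg (aS S) (φ t) ≡ outdeg (arc T) t
    indeg-one  : ∀ v → vS S v ≡ true → v ≢ root N → indeg (aS S) v ≡ 1
    suppressed : ∀ v → vS S v ≡ true → (∀ t → φ t ≢ v) → outdeg (aS S) v ≡ 1
    φ-arc      : ∀ a b →
                 Arc (arc T) a b ⇔ IPath (aS S) (λ w → ∀ t → φ t ≢ w) (φ a) (φ b)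

ClS : ∀ {m n} → Net m n → Sub n → Fin n → Fin m → Set
ClS N S w x = Path (aS S) w (leaf N x)

Corresponds : ∀ {m n} → Net m n → Sub n → (Fin m → Set) → Fin n → Set
Corresponds N S C w =
  vS S w ≡ true ×
  (∀ x → ClS N S w x ⇔ C x) ×
  (∀ w' → vS S w' ≡ true → (∀ x → ClS N S w' x ⇔ C x) →
     Path (aS S) (root N) w' × Path (aS S) w' w)

module Submission where

-- S is a tree hanging from the root of N: its non-root vertices have a
-- unique S-parent, so S-paths into a common vertex are comparable and
-- distinct S-children have no common S-descendant.  In a tree-child network
-- every vertex reaches a leaf by a tree path (entering only in-degree-one
-- vertices), and a tree path ending in S lies in S; without shortcuts the
-- parents of a reticulation are incomparable.  Let w₀ be the image in S of
-- the T-vertex with cluster C_u.  We show that every N-child of u is an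
-- S-child, that the cluster set of u relative to S is C_u (walking down from
-- w₀ to u, a side branch would leave C_u), and that every S-vertex with
-- cluster set C_u lies above u; acyclicity then yields the lemma.

open import Defs
open import Data.Nat using (ℕ; zero; suc; _+_)
import Data.Nat.Properties as ℕ
open import Data.Fin using (Fin; zero; suc; _≟_)
import Data.Fin.Properties as Fin
open import Data.Fin.Induction using (spo-wellFounded; spo-noetherian)
open import Data.Bool using (Bool; true; false; if_then_else_)
open import Data.List.Properties using (map-tabulate)
open import Data.Nat.ListAction using (sum)
open import Data.Product using (∃; _×_; _,_; proj₁; proj₂)
open import Data.Sum using (_⊎_; inj₁; inj₂)
open import Data.Empty using (⊥; ⊥-elim)
open import Function using (_∘_; flip)
open import Function.Bundles using (_⇔_; mk⇔; Equivalence)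
open import Level using (0ℓ)
open import Relation.Nullary using (¬_; yes; no; Dec)
open import Relation.Binary using (Rel; IsStrictPartialOrder)
open import Relation.Binary.PropositionalEquality
open import Relation.Binary.Construct.Closure.ReflexiveTransitive using (Star; ε; _◅_; _◅◅_)
import Relation.Binary.Construct.Closure.ReflexiveTransitive as Star
open import Relation.Binary.Construct.Closure.Transitive using (TransClosure; [_]; _∷_; _++_)
open import Induction.WellFounded using (WellFounded; Acc; acc; module Subrelation)

count-suc : ∀ {n} (p : Fin (suc n) → Bool) →
            count p ≡ (if p zero then 1 else 0) + count (p ∘ suc)
count-suc p = cong (λ xs → (if p zero then 1 else 0) + sum xs)
  (trans (map-tabulate suc f) (sym (map-tabulate (λ w → w) (f ∘ suc))))
  where
    f : Fin _ → ℕ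
    f w = if p w then 1 else 0

count-true : ∀ {n} (p : Fin (suc n) → Bool) → p zero ≡ true →
             count p ≡ suc (count (p ∘ suc))
count-true p p₀ = trans (count-suc p) (cong (λ b → (if b then 1 else 0) + count (p ∘ suc)) p₀)

count-false : ∀ {n} (p : Fin (suc n) → Bool) → p zero ≡ false →
              count p ≡ count (p ∘ suc)
count-false p p₀ = trans (count-suc p) (cong (λ b → (if b then 1 else 0) + count (p ∘ suc)) p₀)

-- case split on a Boolean without abstracting it elsewhere in the context
bool-cases : (b : Bool) → b ≡ true ⊎ b ≡ false
bool-cases true = inj₁ refl
bool-cases false = inj₂ refl

count-zero : ∀ {n} (p : Fin n → Bool) {a} → count p ≡ 0 → p a ≡ true → ⊥
count-zero p {zero} c pa = ℕ.0≢1+n (trans (sym c) (count-true p pa))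
count-zero p {suc a} c pa with bool-cases (p zero)
... | inj₁ p₀ = ℕ.0≢1+n (trans (sym c) (count-true p p₀))
... | inj₂ p₀ = count-zero (p ∘ suc) (trans (sym (count-false p p₀)) c) pa

count-witness : ∀ {n} (p : Fin n → Bool) {k} → count p ≡ suc k → ∃ λ w → p w ≡ true
count-witness {zero} p ()
count-witness {suc n} p c with bool-cases (p zero)
... | inj₁ p₀ = zero , p₀
... | inj₂ p₀ with count-witness (p ∘ suc) (trans (sym (count-false p p₀)) c)
... | w , pw = suc w , pw

count-one-at-zero : ∀ {n} (p : Fin (suc n) → Bool) {a} → count p ≡ 1 →
                    p zero ≡ true → p (suc a) ≡ true → ⊥
count-one-at-zero p c p₀ =
  count-zero (p ∘ suc) (ℕ.suc-injective (trans (sym (count-true p p₀)) c))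

count-one-unique : ∀ {n} (p : Fin n → Bool) {a b} → count p ≡ 1 →
                   p a ≡ true → p b ≡ true → a ≡ b
count-one-unique p {zero} {zero} c pa pb = refl
count-one-unique p {zero} {suc b} c pa pb = ⊥-elim (count-one-at-zero p c pa pb)
count-one-unique p {suc a} {zero} c pa pb = ⊥-elim (count-one-at-zero p c pb pa)
count-one-unique p {suc a} {suc b} c pa pb with bool-cases (p zero)
... | inj₁ p₀ = ⊥-elim (count-one-at-zero p c p₀ pa)
... | inj₂ p₀ = cong suc (count-one-unique (p ∘ suc) (trans (sym (count-false p p₀)) c) pa pb)

count-two-distinct : ∀ {n} (p : Fin n → Bool) → count p ≡ 2 →
                     ∃ λ a → ∃ λ b → a ≢ b × p a ≡ true × p b ≡ true
count-two-distinct {zero} p ()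
count-two-distinct {suc n} p c with bool-cases (p zero)
... | inj₁ p₀ with count-witness (p ∘ suc) (ℕ.suc-injective (trans (sym (count-true p p₀)) c))
...   | b , pb = zero , suc b , (λ ()) , p₀ , pb
count-two-distinct {suc n} p c | inj₂ p₀
  with count-two-distinct (p ∘ suc) (trans (sym (count-false p p₀)) c)
...   | a , b , a≢b , pa , pb = suc a , suc b , a≢b ∘ Fin.suc-injective , pa , pb

module _ {a ℓ} {V : Set a} {R : Rel V ℓ} where

  _◅⁺_ : ∀ {x y z} → R x y → Star R y z → TransClosure R x z
  r ◅⁺ ε = [ r ]
  r ◅⁺ (r' ◅ s) = r ∷ (r' ◅⁺ s)

  _▸_ : ∀ {x y z} → Star R x y → R y z → Star R x z
  s ▸ r = s ◅◅ (r ◅ ε)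

  unsnoc : ∀ {x y} → Star R x y → x ≡ y ⊎ ∃ λ z → Star R x z × R z y
  unsnoc ε = inj₁ refl
  unsnoc (r ◅ s) with unsnoc s
  ... | inj₁ refl = inj₂ (_ , ε , r)
  ... | inj₂ (z , s' , r') = inj₂ (z , r ◅ s' , r')

-- In an acyclic relation on a finite set, the transitive closure is a
-- strict partial order, so both descending and ascending recursion along
-- arcs are well founded.
module _ {n} {R : Rel (Fin n) 0ℓ} (acyclic : ∀ v → ¬ TransClosure R v v) where

  private
    closure-spo : IsStrictPartialOrder _≡_ (TransClosure R)
    closure-spo = record
      { isEquivalence = isEquivalence
      ; irrefl        = λ { refl → acyclic _ }
      ; trans         = _++_
      ; <-resp-≈      = (λ { refl r → r }) , (λ { refl r → r })
      }

  descendants-wf : WellFounded (flip R)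
  descendants-wf = Subrelation.wellFounded [_] (spo-noetherian closure-spo)

  ancestors-wf : WellFounded R
  ancestors-wf = Subrelation.wellFounded [_] (spo-wellFounded closure-spo)

  path-antisym : ∀ {x y} → Star R x y → Star R y x → x ≡ y
  path-antisym ε _ = refl
  path-antisym (r ◅ s) t = ⊥-elim (acyclic _ (r ◅⁺ (s ◅◅ t)))

removeArc-other : ∀ {n} (A : Adj n) {p c a b} → a ≢ p ⊎ b ≢ c →
                  removeArc A p c a b ≡ A a b
removeArc-other A {p} {c} {a} {b} h with a ≟ p | b ≟ c
removeArc-other A (inj₁ a≢p) | yes a≡p | yes _ = ⊥-elim (a≢p a≡p)
removeArc-other A (inj₂ b≢c) | yes _ | yes b≡c = ⊥-elim (b≢c b≡c)
... | yes _ | no _ = refl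
... | no _ | _ = refl

module NetworkProperties {m n} (N : Net m n) (proper : IsProperNetwork N) where

  A : Adj n
  A = arc N

  acyclic : Acyclic A
  acyclic = proj₁ proper

  root-indeg : indeg A (root N) ≡ 0
  root-indeg = proj₁ (proj₂ proper)

  vertex-kinds : ∀ v → v ≢ root N →
    (IsLeaf N v × indeg A v ≡ 1) ⊎ IsTreeVertex N v ⊎ IsReticulation N v
  vertex-kinds = proj₁ (proj₂ (proj₂ (proj₂ proper)))

  leaf-is-leaf : ∀ x → IsLeaf N (leaf N x)
  leaf-is-leaf = proj₁ (proj₂ (proj₂ (proj₂ (proj₂ (proj₂ proper)))))

  leaf-labelled : ∀ v → IsLeaf N v → ∃ λ x → leaf N x ≡ v
  leaf-labelled = proj₂ (proj₂ (proj₂ (proj₂ (proj₂ (proj₂ proper)))))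

  arc-head-not-root : ∀ {p v} → Arc A p v → v ≢ root N
  arc-head-not-root e refl = count-zero (λ w → A w (root N)) root-indeg e

  leaf-childless : ∀ {x v} → ¬ Arc A (leaf N x) v
  leaf-childless {x} = count-zero (A (leaf N x)) (leaf-is-leaf x)

  sole-parent : ∀ {v p q} → indeg A v ≡ 1 → Arc A p v → Arc A q v → p ≡ q
  sole-parent {v} d = count-one-unique (λ w → A w v) d

  indeg-one-or-reticulation : ∀ {p v} → Arc A p v → indeg A v ≡ 1 ⊎ IsReticulation N v
  indeg-one-or-reticulation e with vertex-kinds _ (arc-head-not-root e)
  ... | inj₁ (_ , d) = inj₁ d
  ... | inj₂ (inj₁ (d , _)) = inj₁ d
  ... | inj₂ (inj₂ ret) = inj₂ ret

  tree-or-leaf-indeg-one : ∀ {p v} → Arc A p v → IsTreeVertex N v ⊎ IsLeaf N v → indeg A v ≡ 1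
  tree-or-leaf-indeg-one e (inj₁ (d , _)) = d
  tree-or-leaf-indeg-one e (inj₂ isLeaf) with indeg-one-or-reticulation e
  ... | inj₁ d = d
  ... | inj₂ (_ , outdeg≡1) with () ← trans (sym outdeg≡1) isLeaf

  data TreePath : Fin n → Fin n → Set where
    tree-end  : ∀ {v} → TreePath v v
    tree-step : ∀ {v w z} → Arc A v w → indeg A w ≡ 1 → TreePath w z → TreePath v z

  treePath⇒path : ∀ {v z} → TreePath v z → Path A v z
  treePath⇒path tree-end = ε
  treePath⇒path (tree-step e _ t) = e ◅ treePath⇒path t

  treePath-to-leaf : IsTreeChild N → ∀ v → ∃ λ x → TreePath v (leaf N x)
  treePath-to-leaf tree-child v = go v (descendants-wf acyclic v)
    where
      go : ∀ v → Acc (flip (Arc A)) v → ∃ λ x → TreePath v (leaf N x)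
      go v (acc below) with outdeg A v ℕ.≟ 0
      ... | yes isLeaf with leaf-labelled v isLeaf
      ...   | x , refl = x , tree-end
      go v (acc below) | no notLeaf with tree-child v notLeaf
      ...   | w , e , kind with go w (below e)
      ...     | x , t = x , tree-step e (tree-or-leaf-indeg-one e kind) t

  -- a path into the end of a tree path from p passes through p or starts on
  -- the tree path, since each vertex of the tree path after p has one parent
  treePath-entry : ∀ {p l s} → TreePath p l → Path A s l → Path A s p ⊎ TreePath p s
  treePath-entry tree-end q = inj₁ q
  treePath-entry (tree-step e d t) q with treePath-entry t q
  ... | inj₂ t' = inj₂ (tree-step e d t')
  ... | inj₁ s→w with unsnoc s→w
  ...   | inj₁ refl = inj₂ (tree-step e d tree-end)
  ...   | inj₂ (r , s→r , r→w) = inj₁ (subst (Path A _) (sole-parent d r→w e) s→r)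

  avoid-or-traverse : ∀ p c {s t} → Path A s t →
                      Path (removeArc A p c) s t ⊎ (Path A s p × Path A c t)
  avoid-or-traverse p c ε = inj₁ ε
  avoid-or-traverse p c {s} (_◅_ {j = s₁} e rest) with avoid-or-traverse p c rest
  ... | inj₂ (s₁→p , c→t) = inj₂ (e ◅ s₁→p , c→t)
  ... | inj₁ avoiding with s ≟ p | s₁ ≟ c
  ...   | yes refl | yes refl = inj₂ (ε , rest)
  ...   | yes _ | no s₁≢c = inj₁ (trans (removeArc-other A (inj₂ s₁≢c)) e ◅ avoiding)
  ...   | no s≢p | _ = inj₁ (trans (removeArc-other A (inj₁ s≢p)) e ◅ avoiding)

  module ShortcutFree (no-shortcut : ∀ u v → ¬ IsShortcut N u v) where

    no-bypass : ∀ {p c q} → Arc A p c → IsReticulation N c → Arc A p q → Path A q c → q ≡ c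
    no-bypass {p} {c} {q} p→c ret p→q q→c with q ≟ c
    ... | yes q≡c = q≡c
    ... | no q≢c with avoid-or-traverse p c q→c
    ...   | inj₁ avoiding =
            ⊥-elim (no-shortcut p c (p→c , ret , trans (removeArc-other A (inj₂ q≢c)) p→q ◅ avoiding))
    ...   | inj₂ (q→p , _) = ⊥-elim (acyclic p (p→q ◅⁺ q→p))

    reticulation-parents-incomparable : ∀ {u p c} → Arc A u c → Arc A p c → p ≢ u →
                                        IsReticulation N c → ¬ Path A u p
    reticulation-parents-incomparable u→c p→c p≢u ret ε = p≢u refl
    reticulation-parents-incomparable {p = p} u→c p→c p≢u ret (e ◅ q→p)
      with no-bypass u→c ret e (q→p ▸ p→c)
    ... | refl = acyclic p (p→c ◅⁺ q→p)

  module EmbeddingProperties {k} (T : Net m k) (S : Sub n) (E : IsEmbedding N T S) where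

    open IsEmbedding E

    B : Adj n
    B = aS S

    inS : Fin n → Bool
    inS = vS S

    embedded-path : ∀ {x y} → Path B x y → Path A x y
    embedded-path = Star.map (sub-arc _ _)

    S-parent : ∀ {v} → inS v ≡ true → v ≢ root N → ∃ λ p → Arc B p v
    S-parent {v} v-in-S v≢root = count-witness (λ w → B w v) (indeg-one v v-in-S v≢root)

    S-parent-unique : ∀ {v p q} → Arc B p v → Arc B q v → p ≡ q
    S-parent-unique {v} p→v =
      count-one-unique (λ w → B w v)
        (indeg-one v (sub-head _ _ p→v) (arc-head-not-root (sub-arc _ _ p→v))) p→v

    indeg-one-arc-in-S : ∀ {p v} → inS v ≡ true → indeg A v ≡ 1 → Arc A p v → Arc B p v
    indeg-one-arc-in-S {p} {v} v-in-S d p→v with S-parent v-in-S (arc-head-not-root p→v)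
    ... | q , q→v = subst (λ z → Arc B z v) (sole-parent d (sub-arc _ _ q→v) p→v) q→v

    treePath-in-S : ∀ {v z} → TreePath v z → inS z ≡ true → inS v ≡ true × Path B v z
    treePath-in-S tree-end z-in-S = z-in-S , ε
    treePath-in-S (tree-step e d t) z-in-S with treePath-in-S t z-in-S
    ... | w-in-S , w→z = sub-tail _ _ e' , e' ◅ w→z
      where e' = indeg-one-arc-in-S w-in-S d e

    leaf-in-S : ∀ x → inS (leaf N x) ≡ true
    leaf-in-S x = subst (λ z → inS z ≡ true) (φ-leaf x) (φ-in (leaf T x))

    S-paths-comparable : ∀ {p q l} → Path B p l → Path B q l → Path B p q ⊎ Path B q p
    S-paths-comparable ε q→l = inj₂ q→l
    S-paths-comparable (e ◅ p₁→l) q→l with S-paths-comparable p₁→l q→l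
    ... | inj₁ p₁→q = inj₁ (e ◅ p₁→q)
    ... | inj₂ q→p₁ with unsnoc q→p₁
    ...   | inj₁ refl = inj₁ (e ◅ ε)
    ...   | inj₂ (r , q→r , r→p₁) = inj₂ (subst (Path B _) (S-parent-unique r→p₁ e) q→r)

    sibling-not-above : ∀ {v c₁ c₂} → Arc B v c₁ → Arc B v c₂ → c₁ ≢ c₂ → ¬ Path B c₁ c₂
    sibling-not-above {v} v→c₁ v→c₂ c₁≢c₂ c₁→c₂ with unsnoc c₁→c₂
    ... | inj₁ c₁≡c₂ = c₁≢c₂ c₁≡c₂
    ... | inj₂ (r , c₁→r , r→c₂) with S-parent-unique r→c₂ v→c₂
    ...   | refl = acyclic v (sub-arc _ _ v→c₁ ◅⁺ embedded-path c₁→r)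

    S-children-disjoint : ∀ {v c₁ c₂ l} → Arc B v c₁ → Arc B v c₂ → c₁ ≢ c₂ →
                          Path B c₁ l → Path B c₂ l → ⊥
    S-children-disjoint v→c₁ v→c₂ c₁≢c₂ c₁→l c₂→l with S-paths-comparable c₁→l c₂→l
    ... | inj₁ c₁→c₂ = sibling-not-above v→c₁ v→c₂ c₁≢c₂ c₁→c₂
    ... | inj₂ c₂→c₁ = sibling-not-above v→c₂ v→c₁ (c₁≢c₂ ∘ sym) c₂→c₁

    reachable-from-root : ∀ v → inS v ≡ true → Path B (root N) v
    reachable-from-root v = go v (ancestors-wf acyclic v)
      where
        go : ∀ v → Acc (Arc A) v → inS v ≡ true → Path B (root N) v
        go v (acc above) v-in-S with v ≟ root N
        ... | yes refl = ε
        ... | no v≢root with S-parent v-in-S v≢root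
        ...   | p , p→v = go p (above (sub-arc _ _ p→v)) (sub-tail _ _ p→v) ▸ p→v

    Suppressed : Fin n → Set
    Suppressed w = ∀ t → φ t ≢ w

    suppressed-path : ∀ {a b} → IPath B Suppressed a b → Path B a b
    suppressed-path (one e) = e ◅ ε
    suppressed-path (step e _ ip) = e ◅ suppressed-path ip

    suppressed-snoc : ∀ {a b c} → IPath B Suppressed a b → Suppressed b → Arc B b c →
                      IPath B Suppressed a c
    suppressed-snoc (one e) b-sup e' = step e b-sup (one e')
    suppressed-snoc (step e w-sup ip) b-sup e' = step e w-sup (suppressed-snoc ip b-sup e')

    T-path⇒S-path : ∀ {t s} → Path (arc T) t s → Path B (φ t) (φ s)
    T-path⇒S-path ε = ε
    T-path⇒S-path (e ◅ r) = suppressed-path (Equivalence.to (φ-arc _ _) e) ◅◅ T-path⇒S-path r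

    -- v is φ t, or hangs below φ t on the subdivision of a T-arc out of t
    Below : Fin k → Fin n → Set
    Below t v = (φ t ≡ v) ⊎ (IPath B Suppressed (φ t) v × Suppressed v)

    S-path⇒T-path : ∀ {v s} → Path B v (φ s) → ∀ t → Below t v → Path (arc T) t s
    S-path⇒T-path ε t (inj₁ φt≡φs) = subst (Path (arc T) t) (φ-inj φt≡φs) ε
    S-path⇒T-path {s = s} ε t (inj₂ (_ , v-sup)) = ⊥-elim (v-sup s refl)
    S-path⇒T-path {v} (_◅_ {j = v₂} e rest) t below =
      extend (reach-v₂ below) (Fin.any? (λ t' → φ t' ≟ v₂))
      where
        reach-v₂ : Below t v → IPath B Suppressed (φ t) v₂
        reach-v₂ (inj₁ φt≡v) = one (subst (λ z → Arc B z v₂) (sym φt≡v) e)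
        reach-v₂ (inj₂ (ip , v-sup)) = suppressed-snoc ip v-sup e
        extend : IPath B Suppressed (φ t) v₂ → Dec (∃ λ t' → φ t' ≡ v₂) → Path (arc T) t _
        extend φt→v₂ (yes (t' , φt'≡v₂)) =
          Equivalence.from (φ-arc t t') (subst (IPath B Suppressed (φ t)) (sym φt'≡v₂) φt→v₂)
            ◅ S-path⇒T-path rest t' (inj₁ φt'≡v₂)
        extend φt→v₂ (no unseen) =
          S-path⇒T-path rest t (inj₂ (φt→v₂ , λ t' eq → unseen (t' , eq)))

    φ-cluster : ∀ t x → ClS N S (φ t) x ⇔ Cl T t x
    φ-cluster t x =
      mk⇔ (λ p → S-path⇒T-path (subst (Path B (φ t)) (sym (φ-leaf x)) p) t (inj₁ refl))
          (λ p → subst (Path B (φ t)) (φ-leaf x) (T-path⇒S-path p))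

    module ClusterOfTreeVertex
      (tree-child : IsTreeChild N) (no-shortcut : ∀ u v → ¬ IsShortcut N u v)
      (u : Fin n) (u-tree : IsTreeVertex N u)
      (t₀ : Fin k) (t₀-cluster : ∀ x → Cl T t₀ x ⇔ Cl N u x) where

      open ShortcutFree no-shortcut

      w₀ : Fin n
      w₀ = φ t₀

      into-w₀ : ∀ x → Cl N u x → ClS N S w₀ x
      into-w₀ x = Equivalence.from (φ-cluster t₀ x) ∘ Equivalence.from (t₀-cluster x)

      out-of-w₀ : ∀ x → ClS N S w₀ x → Cl N u x
      out-of-w₀ x = Equivalence.to (t₀-cluster x) ∘ Equivalence.to (φ-cluster t₀ x)

      u-leaf : ∃ λ x → TreePath u (leaf N x)
      u-leaf = treePath-to-leaf tree-child u

      x₀ : Fin m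
      x₀ = proj₁ u-leaf

      u-in-S : inS u ≡ true
      u-in-S = proj₁ (treePath-in-S (proj₂ u-leaf) (leaf-in-S x₀))

      u→x₀ : Path B u (leaf N x₀)
      u→x₀ = proj₂ (treePath-in-S (proj₂ u-leaf) (leaf-in-S x₀))

      S-leaf-below : ∀ {v c} → Arc B v c → ∃ λ l → Path B c (leaf N l)
      S-leaf-below {c = c} _ with treePath-to-leaf tree-child c
      ... | l , c⇝l = l , proj₂ (treePath-in-S c⇝l (leaf-in-S l))

      -- a parent p ≠ u of a reticulation child of u has no S-path to w₀ and
      -- none from w₀: each would make p and u comparable in N
      other-parent-off-w₀ : ∀ {p c} → Arc A u c → Arc A p c → p ≢ u → IsReticulation N c →
                            Path B p w₀ ⊎ Path B w₀ p → ⊥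
      other-parent-off-w₀ {p} u→c p→c p≢u ret = λ
        { (inj₁ p→w₀) → incomparable (S-paths-comparable (p→w₀ ◅◅ into-w₀ x₀ u-reaches-x₀) u→x₀)
        ; (inj₂ w₀→p) → below-w₀ w₀→p (treePath-to-leaf tree-child p) }
        where
          u-reaches-x₀ : Cl N u x₀
          u-reaches-x₀ = embedded-path u→x₀

          incomparable : Path B p u ⊎ Path B u p → ⊥
          incomparable (inj₁ p→u) =
            reticulation-parents-incomparable p→c u→c (p≢u ∘ sym) ret (embedded-path p→u)
          incomparable (inj₂ u→p) =
            reticulation-parents-incomparable u→c p→c p≢u ret (embedded-path u→p)

          below-w₀ : Path B w₀ p → (∃ λ l → TreePath p (leaf N l)) → ⊥
          below-w₀ w₀→p (l , p⇝l)
            with treePath-entry p⇝l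
                   (out-of-w₀ l (w₀→p ◅◅ proj₂ (treePath-in-S p⇝l (leaf-in-S l))))
          ... | inj₁ u→p = reticulation-parents-incomparable u→c p→c p≢u ret u→p
          ... | inj₂ p⇝u =
                reticulation-parents-incomparable p→c u→c (p≢u ∘ sym) ret (treePath⇒path p⇝u)

      child-in-S : ∀ {c} → Arc A u c → Arc B u c
      child-in-S {c} u→c with treePath-to-leaf tree-child c
      ... | y , c⇝y with treePath-in-S c⇝y (leaf-in-S y)
      ... | c-in-S , c→y with S-parent c-in-S (arc-head-not-root u→c)
      ... | p , p→c with p ≟ u
      ... | yes refl = p→c
      ... | no p≢u with indeg-one-or-reticulation u→c
      ... | inj₁ d = ⊥-elim (p≢u (sole-parent d (sub-arc _ _ p→c) u→c))
      ... | inj₂ ret = ⊥-elim (other-parent-off-w₀ u→c (sub-arc _ _ p→c) p≢u ret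
                        (S-paths-comparable (p→c ◅ c→y) (into-w₀ y (u→c ◅ treePath⇒path c⇝y))))

      other-S-child : ∀ c → ∃ λ d → Arc B u d × d ≢ c
      other-S-child c with count-two-distinct (A u) (proj₂ u-tree)
      ... | c₁ , c₂ , c₁≢c₂ , u→c₁ , u→c₂ with c₁ ≟ c
      ... | yes refl = c₂ , child-in-S u→c₂ , c₁≢c₂ ∘ sym
      ... | no c₁≢c = c₁ , child-in-S u→c₁ , c₁≢c

      -- a vertex v above u in S whose cluster set lies within C_u has no
      -- S-child v' besides the one towards u: a leaf below v' lies in C_u,
      -- so u reaches v' or v' reaches u, which normality forbids
      no-side-branch : ∀ {v v₁ v'} → Arc B v v₁ → Arc B v v' → v' ≢ v₁ → Path B v₁ u →
                       (∀ l → ClS N S v l → Cl N u l) → ⊥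
      no-side-branch {v} {v₁} {v'} v→v₁ v→v' v'≢v₁ v₁→u within
        with treePath-to-leaf tree-child v'
      ... | l , v'⇝l
        with treePath-entry v'⇝l (within l (v→v' ◅ proj₂ (treePath-in-S v'⇝l (leaf-in-S l))))
      ... | inj₂ v'⇝u = S-children-disjoint v→v₁ v→v' (v'≢v₁ ∘ sym) v₁→u
                           (proj₂ (treePath-in-S v'⇝u u-in-S))
      ... | inj₁ u→v' with indeg-one-or-reticulation (sub-arc _ _ v→v')
      ... | inj₂ ret = v'≢v₁ (sym (no-bypass (sub-arc _ _ v→v') ret (sub-arc _ _ v→v₁)
                                              (embedded-path v₁→u ◅◅ u→v')))
      ... | inj₁ d with unsnoc u→v'
      ...   | inj₁ refl = S-children-disjoint v→v₁ v→v' (v'≢v₁ ∘ sym) v₁→u ε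
      ...   | inj₂ (r , u→r , r→v') with sole-parent d r→v' (sub-arc _ _ v→v')
      ...     | refl = acyclic v (sub-arc _ _ v→v₁ ◅⁺ (embedded-path v₁→u ◅◅ u→r))

      funnel : ∀ {v} → Path B v u → (∀ l → ClS N S v l → Cl N u l) →
               ∀ l → ClS N S v l → ClS N S u l
      funnel ε _ l v→l = v→l
      funnel (v→v₁ ◅ _) _ l ε = ⊥-elim (leaf-childless (sub-arc _ _ v→v₁))
      funnel (_◅_ {j = v₁} v→v₁ v₁→u) within l (_◅_ {j = v'} v→v' v'→l) with v' ≟ v₁
      ... | yes refl = funnel v₁→u (λ l' v₁→l' → within l' (v→v₁ ◅ v₁→l')) l v'→l
      ... | no v'≢v₁ = ⊥-elim (no-side-branch v→v₁ v→v' v'≢v₁ v₁→u within)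

      u-cluster : ∀ l → ClS N S u l ⇔ Cl N u l
      u-cluster l = mk⇔ embedded-path reach
        where
          reach : Cl N u l → ClS N S u l
          reach u→l with S-paths-comparable u→x₀ (into-w₀ x₀ (embedded-path u→x₀))
          ... | inj₁ u→w₀ = u→w₀ ◅◅ into-w₀ l u→l
          ... | inj₂ w₀→u = funnel w₀→u out-of-w₀ l (into-w₀ l u→l)

      -- every S-vertex with cluster set C_u lies above u in S: otherwise it
      -- would lie below one S-child of u while C_u meets the other
      above-u : ∀ w → (∀ x → ClS N S w x ⇔ Cl N u x) → Path B w u
      above-u w w-cluster
        with S-paths-comparable (Equivalence.from (w-cluster x₀) (embedded-path u→x₀)) u→x₀
      ... | inj₁ w→u = w→u
      ... | inj₂ ε = ε
      ... | inj₂ (_◅_ {j = c} u→c c→w) with other-S-child c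
      ... | d , u→d , d≢c with S-leaf-below u→d
      ... | l , d→l = ⊥-elim (S-children-disjoint u→c u→d (d≢c ∘ sym)
                        (c→w ◅◅ Equivalence.from (w-cluster l) (embedded-path (u→d ◅ d→l))) d→l)

      u-corresponds : Corresponds N S (Cl N u) u
      u-corresponds = u-in-S , u-cluster ,
                      λ w w-in-S w-cluster → reachable-from-root w w-in-S , above-u w w-cluster

      corresponding-vertex-unique : ∀ w → Corresponds N S (Cl N u) w → w ≡ u
      corresponding-vertex-unique w (_ , w-cluster , lowest) =
        path-antisym acyclic (embedded-path (above-u w w-cluster))
                             (embedded-path (proj₂ (lowest u u-in-S u-cluster)))

-- Lemma 2.4.  The single-vertex network has no tree vertex; for a proper
-- normal network the statement is the argument above.

lemma2p4 : ∀ {m n k} (N : Net m n) (u : Fin n) (T : Net m k) (S : Sub n) →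
           IsNormal N → IsTreeVertex N u →
           IsPhyloTree T → IsCluster T (Cl N u) →
           IsEmbedding N T S →
           Corresponds N S (Cl N u) u ×
           (∀ w → Corresponds N S (Cl N u) w → w ≡ u)
lemma2p4 N u T S (inj₁ proper , tree-child , no-shortcut) u-tree _ (t₀ , t₀-cluster) E =
  u-corresponds , corresponding-vertex-unique
  where
    open NetworkProperties N proper
    open EmbeddingProperties T S E
    open ClusterOfTreeVertex tree-child no-shortcut u u-tree t₀ t₀-cluster
lemma2p4 N u T S (inj₂ (_ , _ , no-arcs) , _) u-tree _ _ _
  with count-witness (arc N u) (proj₂ u-tree)
... | w , u→w with () ← trans (sym (no-arcs u w)) u→w
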